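{- Let $G$ be an ordered abelian group, $p$ a prime, $L\leq K\leq G$ convex subgroups and $r\geq1$. Then $L+pG=K+pG$ if and only if $L+p^rG=K+p^rG$. -}

module Defs where

open import Level using (Level; _⊔_; suc)
open import Data.Nat.Base using (ℕ)
open import Data.Product using (_×_; Σ-syntax; ∃-syntax; _,_)
open import Algebra.Bundles using (AbelianGroup)
open import Relation.Binary.Structures using (IsTotalOrder)
open import Relation.Unary using (Pred; _⊆_)
import Algebra.Definitions.RawMonoid as RawMonoidDefs

-- An ordered abelian group: an abelian group (written multiplicatively in the
-- stdlib bundle, i.e. _∙_, ε, _⁻¹, read here as +, 0, -) with a total order
-- compatible with the group operation:  a ≤ b  ⇒  a + c ≤ b + c.
record OrderedAbelianGroup (c ℓ₁ ℓ₂ : Level) : Set (suc (c ⊔ ℓ₁ ⊔ ℓ₂)) where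
  field
    abelianGroup : AbelianGroup c ℓ₁
  open AbelianGroup abelianGroup public
  field
    _≤_          : Carrier → Carrier → Set ℓ₂
    isTotalOrder : IsTotalOrder _≈_ _≤_
    ≤-compat     : ∀ {a b} (x : Carrier) → a ≤ b → (a ∙ x) ≤ (b ∙ x)

  _·_ : ℕ → Carrier → Carrier
  _·_ = RawMonoidDefs._×_ rawMonoid

module _ {c ℓ₁ ℓ₂ : Level} (G : OrderedAbelianGroup c ℓ₁ ℓ₂) where
  open OrderedAbelianGroup G

  record IsSubgroup {ℓ : Level} (H : Pred Carrier ℓ) : Set (c ⊔ ℓ₁ ⊔ ℓ) where
    field
      resp  : ∀ {x y} → x ≈ y → H x → H y
      ε∈    : H ε
      ∙-closed : ∀ {x y} → H x → H y → H (x ∙ y)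
      ⁻¹-closed : ∀ {x} → H x → H (x ⁻¹)

  record IsConvexSubgroup {ℓ : Level} (H : Pred Carrier ℓ) : Set (c ⊔ ℓ₁ ⊔ ℓ₂ ⊔ ℓ) where
    field
      isSubgroup : IsSubgroup H
      convex     : ∀ {a b d} → H a → H d → a ≤ b → b ≤ d → H b

  _+_G : {ℓ : Level} → Pred Carrier ℓ → ℕ → Pred Carrier (c ⊔ ℓ₁ ⊔ ℓ)
  (H + n G) x = ∃[ h ] ∃[ g ] (H h × (x ≈ (h ∙ (n · g))))

  _≐_ : {ℓ ℓ' : Level} → Pred Carrier ℓ → Pred Carrier ℓ' → Set (c ⊔ ℓ ⊔ ℓ')
  A ≐ B = (A ⊆ B) × (B ⊆ A)

{-# OPTIONS --safe #-}
module Submission where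

open import Defs
open import Level using (Level; _⊔_)
open import Data.Nat.Base using (ℕ; zero; suc; _*_; _^_; _≤_)
open import Data.Nat.Primality using (Prime)
open import Data.Product using (_,_)
open import Data.Sum using (inj₁; inj₂)
open import Function.Bundles using (_⇔_; mk⇔; Equivalence)
open import Relation.Unary using (Pred; _⊆_)
open import Relation.Binary.Structures using (IsTotalOrder)

-- As L ⊆ K, the equality L + nG = K + nG amounts to K ⊆ L + nG.  Convex
-- subgroups are isolated: g lies between 0 and (1+n)g, so (1+n)g ∈ K forces
-- g ∈ K.  Hence if K ⊆ L + pG and k = l + pg with k ∈ K, then g ∈ K, so
-- g ∈ L + p^r G by induction and k ∈ L + p^(r+1) G.  The converse holds since
-- L + p^r G ⊆ L + pG for r ≥ 1.

module OrderedAbelianGroupProperties {c ℓ₁ ℓ₂ : Level} (G : OrderedAbelianGroup c ℓ₁ ℓ₂) where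
  open OrderedAbelianGroup G renaming (_≤_ to _≤G_)
  open IsTotalOrder isTotalOrder using (total)
    renaming (refl to ≤-refl; trans to ≤-trans; ≤-respˡ-≈ to ≤-respˡ; ≤-respʳ-≈ to ≤-respʳ)
  open import Algebra.Properties.Group group using (\\-leftDividesʳ)
  open import Algebra.Properties.CommutativeMonoid.Mult commutativeMonoid
    using (×-distrib-+; ×-assocˡ; ×-congʳ)
  open import Relation.Binary.Reasoning.Setoid setoid

  module _ {g : Carrier} (ε≤g : ε ≤G g) where
    ε≤g⇒ε≤n·g : ∀ n → ε ≤G (n · g)
    ε≤g⇒g≤[1+n]·g : ∀ n → g ≤G (suc n · g)
    ε≤g⇒ε≤n·g zero = ≤-refl
    ε≤g⇒ε≤n·g (suc n) = ≤-trans ε≤g (ε≤g⇒g≤[1+n]·g n)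
    ε≤g⇒g≤[1+n]·g n = ≤-respʳ (comm _ _) (≤-respˡ (identityˡ g) (≤-compat g (ε≤g⇒ε≤n·g n)))

  module _ {g : Carrier} (g≤ε : g ≤G ε) where
    g≤ε⇒n·g≤ε : ∀ n → (n · g) ≤G ε
    g≤ε⇒[1+n]·g≤g : ∀ n → (suc n · g) ≤G g
    g≤ε⇒n·g≤ε zero = ≤-refl
    g≤ε⇒n·g≤ε (suc n) = ≤-trans (g≤ε⇒[1+n]·g≤g n) g≤ε
    g≤ε⇒[1+n]·g≤g n = ≤-respˡ (comm _ _) (≤-respʳ (identityˡ g) (≤-compat g (g≤ε⇒n·g≤ε n)))

  ·-zeroʳ : ∀ n → (n · ε) ≈ ε
  ·-zeroʳ zero = refl
  ·-zeroʳ (suc n) = trans (identityˡ _) (·-zeroʳ n)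

  module _ {ℓ : Level} {H : Pred Carrier ℓ} (H-subgroup : IsSubgroup G H) where
    open IsSubgroup H-subgroup

    ·-closed : ∀ n {g} → H g → H (n · g)
    ·-closed zero h = ε∈
    ·-closed (suc n) h = ∙-closed h (·-closed n h)

  module _ {ℓ : Level} {H : Pred Carrier ℓ} (H-convex : IsConvexSubgroup G H) where
    open IsConvexSubgroup H-convex
    open IsSubgroup isSubgroup

    isolated : ∀ n {g} → H (suc n · g) → H g
    isolated n {g} h with total ε g
    ... | inj₁ ε≤g = convex ε∈ h ε≤g (ε≤g⇒g≤[1+n]·g ε≤g n)
    ... | inj₂ g≤ε = convex h ε∈ (g≤ε⇒[1+n]·g≤g g≤ε n) g≤ε

  _+_·G : {ℓ : Level} → Pred Carrier ℓ → ℕ → Pred Carrier (c ⊔ ℓ₁ ⊔ ℓ)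
  L + n ·G = _+_G G L n

  module _ {ℓ : Level} {L : Pred Carrier ℓ} where
    ⊆+·G : ∀ n → L ⊆ L + n ·G
    ⊆+·G n {x} x∈L = x , ε , x∈L , sym (trans (∙-congˡ (·-zeroʳ n)) (identityʳ x))

    +·G-resp : ∀ n {x y} → x ≈ y → (L + n ·G) x → (L + n ·G) y
    +·G-resp n x≈y (l , g , l∈L , x≈l+ng) = l , g , l∈L , trans (sym x≈y) x≈l+ng

    +1·G-full : IsSubgroup G L → ∀ x → (L + 1 ·G) x
    +1·G-full L-subgroup x =
      ε , x , IsSubgroup.ε∈ L-subgroup , sym (trans (identityˡ _) (identityʳ x))

    +*·G⊆+·G : ∀ m n → L + (m * n) ·G ⊆ L + m ·G
    +*·G⊆+·G m n (l , g , l∈L , x≈l+mng) =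
      l , n · g , l∈L , trans x≈l+mng (∙-congˡ (sym (×-assocˡ g m n)))

    ∙·∈+*·G : IsSubgroup G L → ∀ {l g} m n → L l → (L + m ·G) g → (L + (n * m) ·G) (l ∙ n · g)
    ∙·∈+*·G L-subgroup {l} {g} m n l∈L (l′ , g′ , l′∈L , g≈l′+mg′) =
      l ∙ n · l′ , g′ , IsSubgroup.∙-closed L-subgroup l∈L (·-closed L-subgroup n l′∈L) , (begin
        l ∙ n · g                         ≈⟨ ∙-congˡ (×-congʳ n g≈l′+mg′) ⟩
        l ∙ n · (l′ ∙ m · g′)             ≈⟨ ∙-congˡ (×-distrib-+ l′ _ n) ⟩
        l ∙ (n · l′ ∙ n · (m · g′))       ≈⟨ assoc _ _ _ ⟨
        (l ∙ n · l′) ∙ n · (m · g′)       ≈⟨ ∙-congˡ (×-assocˡ g′ n m) ⟩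
        (l ∙ n · l′) ∙ (n * m) · g′       ∎)

  module _ {ℓ ℓ′ : Level} {L : Pred Carrier ℓ} {K : Pred Carrier ℓ′} where
    +·G-mono : ∀ n → L ⊆ K → L + n ·G ⊆ K + n ·G
    +·G-mono n L⊆K (l , g , l∈L , x≈l+ng) = l , g , L⊆K l∈L , x≈l+ng

    ⊆+·G⇒+·G⊆+·G : ∀ n → K ⊆ L + n ·G → K + n ·G ⊆ L + n ·G
    ⊆+·G⇒+·G⊆+·G n K⊆L+nG {x} (k , g , k∈K , x≈k+ng) with K⊆L+nG k∈K
    ... | l , g′ , l∈L , k≈l+ng′ = l , g′ ∙ g , l∈L , (begin
        x                   ≈⟨ x≈k+ng ⟩
        k ∙ n · g           ≈⟨ ∙-congʳ k≈l+ng′ ⟩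
        (l ∙ n · g′) ∙ n · g ≈⟨ assoc _ _ _ ⟩
        l ∙ (n · g′ ∙ n · g) ≈⟨ ∙-congˡ (×-distrib-+ g′ g n) ⟨
        l ∙ n · (g′ ∙ g)     ∎)

    ≐⇔⊆+·G : ∀ n → L ⊆ K → _≐_ G (L + n ·G) (K + n ·G) ⇔ (K ⊆ L + n ·G)
    ≐⇔⊆+·G n L⊆K = mk⇔ to from
      where
        to : _≐_ G (L + n ·G) (K + n ·G) → K ⊆ L + n ·G
        to (_ , K+nG⊆L+nG) k∈K = K+nG⊆L+nG (⊆+·G n k∈K)

        from : K ⊆ L + n ·G → _≐_ G (L + n ·G) (K + n ·G)
        from K⊆L+nG = +·G-mono n L⊆K , ⊆+·G⇒+·G⊆+·G n K⊆L+nG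

    ⊆+·G⇒⊆+^·G : IsSubgroup G L → IsConvexSubgroup G K → L ⊆ K →
                 ∀ n → K ⊆ L + n ·G → ∀ r → K ⊆ L + (n ^ r) ·G
    ⊆+·G⇒⊆+^·G L-subgroup _ _ _ _ zero {x} _ = +1·G-full L-subgroup x
    ⊆+·G⇒⊆+^·G _ _ _ zero K⊆L+0G (suc r) = K⊆L+0G
    ⊆+·G⇒⊆+^·G L-subgroup K-convex L⊆K (suc m) K⊆L+nG (suc r) k∈K with K⊆L+nG k∈K
    ... | l , g , l∈L , k≈l+ng =
      +·G-resp (suc m * suc m ^ r) (sym k≈l+ng) (∙·∈+*·G L-subgroup (suc m ^ r) (suc m) l∈L g∈L+n^rG)
      where
        module K = IsSubgroup (IsConvexSubgroup.isSubgroup K-convex)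
        ng∈K : K (suc m · g)
        ng∈K = K.resp (trans (∙-congˡ k≈l+ng) (\\-leftDividesʳ l _))
                      (K.∙-closed (K.⁻¹-closed (L⊆K l∈L)) k∈K)
        g∈K : K g
        g∈K = isolated K-convex m ng∈K
        g∈L+n^rG : (L + (suc m ^ r) ·G) g
        g∈L+n^rG = ⊆+·G⇒⊆+^·G L-subgroup K-convex L⊆K (suc m) K⊆L+nG r g∈K

open OrderedAbelianGroupProperties using (≐⇔⊆+·G; ⊆+·G⇒⊆+^·G; +*·G⊆+·G)

mainTheorem11 : ∀ {c ℓ₁ ℓ₂ ℓ ℓ'} (G : OrderedAbelianGroup c ℓ₁ ℓ₂) (p : ℕ) → Prime p →
    (L : Pred (OrderedAbelianGroup.Carrier G) ℓ) (K : Pred (OrderedAbelianGroup.Carrier G) ℓ') →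
    IsConvexSubgroup G L → IsConvexSubgroup G K → L ⊆ K →
    (r : ℕ) → 1 ≤ r →
    (_≐_ G (_+_G G L p) (_+_G G K p)) ⇔ (_≐_ G (_+_G G L (p ^ r)) (_+_G G K (p ^ r)))
mainTheorem11 G p _ L K L-convex K-convex L⊆K (suc r) _ = mk⇔
  (λ L+pG≐K+pG → from (≐⇔⊆+·G G (p ^ suc r) L⊆K)
    (⊆+·G⇒⊆+^·G G (IsConvexSubgroup.isSubgroup L-convex) K-convex L⊆K p
      (to (≐⇔⊆+·G G p L⊆K) L+pG≐K+pG) (suc r)))
  (λ L+p^rG≐K+p^rG → from (≐⇔⊆+·G G p L⊆K)
    (λ k∈K → +*·G⊆+·G G p (p ^ r) (to (≐⇔⊆+·G G (p ^ suc r) L⊆K) L+p^rG≐K+p^rG k∈K)))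
  where open Equivalence
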